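{- Let $H$ be a connected graph with $n_H\ge 2$ vertices and let $G$ be the GP$5$-graph constructed from $H$. Then for every integer $k\le n_H$, $H$ has a semipaired dominating set of cardinality $k$ if and only if $G$ has a semipaired dominating set of cardinality $2n_H+k$.
   Context: All graphs are finite and simple. Given a connected graph $H=(V_H,E_H)$ with $V_H=\{v_1,\dots,v_{n_H}\}$, the GP$5$-graph constructed from $H$ is $G=(V,E)$ with $V=V_H\cup\{a_i,b_i,c_i,d_i,e_i : i\in[n_H]\}$ (new distinct vertices) and $E=E_H\cup\{v_ic_i,\,c_ib_i,\,c_id_i,\,b_ia_i,\,d_ie_i : i\in[n_H]\}$. For a graph with no isolated vertices, a semipaired dominating set is a set $D$ of vertices such that every vertex outside $D$ has a neighbor in $D$ and $D$ can be partitioned into $2$-element subsets $\{u,v\}$ with the distance between $u$ and $v$ in the graph at most $2$. -}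

module Defs where

open import Data.Nat using (ℕ)
open import Data.Fin using (Fin)
open import Data.Integer using (ℤ; +_)
open import Data.List using (List; []; _∷_; length; concatMap)
open import Data.List.Membership.Propositional using (_∈_)
open import Data.List.Relation.Unary.All using (All)
open import Data.List.Relation.Unary.Unique.Propositional using (Unique)
open import Data.List.Relation.Binary.Permutation.Propositional using (_↭_)
open import Data.Product using (Σ; ∃; ∃-syntax; _×_; _,_)
open import Data.Sum using (_⊎_)
open import Relation.Nullary using (¬_)
open import Relation.Binary.PropositionalEquality using (_≡_)
open import Relation.Binary.Construct.Closure.ReflexiveTransitive using (Star)

record Graph (V : Set) : Set₁ where
  field
    Adj    : V → V → Set
    sym    : ∀ {u v} → Adj u v → Adj v u
    irrefl : ∀ {v} → ¬ Adj v v
open Graph public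

Connected : ∀ {V} → Graph V → Set
Connected {V} G = ∀ (u v : V) → Star (Adj G) u v

Dist≤2 : ∀ {V} → Graph V → V → V → Set
Dist≤2 {V} G u v = u ≡ v ⊎ Adj G u v ⊎ ∃[ w ] (Adj G u w × Adj G w v)

pairsToList : ∀ {V : Set} → List (V × V) → List V
pairsToList = concatMap (λ { (u , v) → u ∷ v ∷ [] })

-- D (a duplicate-free list = finite set of vertices) is a semipaired dominating set
record IsSPDS {V : Set} (G : Graph V) (D : List V) : Set where
  field
    distinct   : Unique D
    dominating : ∀ (x : V) → x ∈ D ⊎ ∃[ y ] (y ∈ D × Adj G x y)
    pairing    : ∃[ ps ] (All (λ { (u , v) → Dist≤2 G u v }) ps × pairsToList ps ↭ D)

HasSPDSOfSize : ∀ {V : Set} → Graph V → ℤ → Set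
HasSPDSOfSize {V} G k = ∃[ D ] (IsSPDS G D × + length D ≡ k)

data GV (n : ℕ) : Set where
  vv aa bb cc dd ee : Fin n → GV n

module _ {n : ℕ} (H : Graph (Fin n)) where
  data GP5Adj : GV n → GV n → Set where
    hE : ∀ {i j} → Adj H i j → GP5Adj (vv i) (vv j)
    vc : ∀ {i} → GP5Adj (vv i) (cc i)
    cv : ∀ {i} → GP5Adj (cc i) (vv i)
    cb : ∀ {i} → GP5Adj (cc i) (bb i)
    bc : ∀ {i} → GP5Adj (bb i) (cc i)
    cd : ∀ {i} → GP5Adj (cc i) (dd i)
    dc : ∀ {i} → GP5Adj (dd i) (cc i)
    ba : ∀ {i} → GP5Adj (bb i) (aa i)
    ab : ∀ {i} → GP5Adj (aa i) (bb i)
    de : ∀ {i} → GP5Adj (dd i) (ee i)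
    ed : ∀ {i} → GP5Adj (ee i) (dd i)

  private
    gsym : ∀ {u v} → GP5Adj u v → GP5Adj v u
    gsym (hE x) = hE (sym H x)
    gsym vc = cv
    gsym cv = vc
    gsym cb = bc
    gsym bc = cb
    gsym cd = dc
    gsym dc = cd
    gsym ba = ab
    gsym ab = ba
    gsym de = ed
    gsym ed = de

    girr : ∀ {v} → ¬ GP5Adj v v
    girr (hE x) = irrefl H x

  GP5 : Graph (GV n)
  GP5 = record { Adj = GP5Adj ; sym = gsym ; irrefl = girr }

-- Forward: add the pairs (b i , d i), at distance 2 through c i, to a semipairing of H; b i and d i dominate their
-- gadget.
-- Backward: each pair of a semipairing of G traces to at most one pair of H-vertices at distance ≤ 2 (v i and c i
-- stand for i), and since a i and e i must be dominated, every gadget owns a pair tracing to nothing. So a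
-- semipaired set of size 2n + 2t leaves at most t traced pairs, and their vertices dominate H. In a connected graph
-- such a family extends to a semipairing with exactly t pairs whenever 2t ≤ n: pairing a spanning tree through
-- common parents gives a semipairing Q missing at most its root, and semipairings inside Q grow one pair at a time
-- along alternating paths.

module Submission where

open import Defs
open import Data.Nat using (ℕ)
open import Data.Fin using (Fin)
open import Data.Integer as ℤ using (ℤ; +_)
import Data.Fin as Fin
import Data.Nat as ℕ
import Data.Product as Prod
open import Data.Unit using (⊤; tt)
open import Data.List using (List; []; _∷_; _++_; length; map; allFin)
open import Data.List.Properties using (++-assoc; length-++; length-map; length-tabulate)
open import Data.List.Membership.Propositional using (_∈_; _∉_)
open import Data.List.Membership.Propositional.Properties
  using (∈-∃++; ∈-++⁻; ∈-++⁺ˡ; ∈-++⁺ʳ; ∈-map⁺; ∈-map⁻; ∈-allFin)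
open import Data.List.Relation.Binary.Disjoint.Propositional using (Disjoint)
open import Data.List.Relation.Binary.Permutation.Propositional
  using (_↭_; refl; prep; swap; trans; ↭-sym; ↭⇒↭ₛ)
open import Data.List.Relation.Binary.Permutation.Propositional.Properties
  using (∈-resp-↭; ↭-length; shift; shifts; ++⁺; ++⁺ˡ; ++⁺ʳ)
import Data.List.Relation.Binary.Permutation.Setoid.Properties as ↭ₛ
open import Data.List.Relation.Binary.Subset.Propositional using (_⊆_)
open import Data.List.Relation.Unary.All as All using (All; []; _∷_)
open import Data.List.Relation.Unary.All.Properties using (¬All⇒Any¬) renaming (++⁺ to All-++⁺)
open import Data.List.Relation.Unary.Any using (here; there)
open import Data.List.Relation.Unary.Unique.Propositional using (Unique; []; _∷_)
import Data.List.Relation.Unary.Unique.Propositional.Properties as Unique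
open import Data.Maybe using (Maybe; just; nothing)
open import Data.Maybe.Relation.Unary.All as Maybe using (just; nothing)
open import Data.Product using (∃; ∃-syntax; ∃₂; _×_; _,_; proj₁; proj₂)
open import Data.Sum using (_⊎_; inj₁; inj₂; [_,_])
open import Function using (id; _∘_)
open import Function.Bundles using (_⇔_; mk⇔)
open import Relation.Binary.Construct.Closure.ReflexiveTransitive using (Star; ε; _◅_)
open import Relation.Binary.Definitions using (DecidableEquality; _Respects_)
open import Relation.Binary.PropositionalEquality as ≡
  using (_≡_; _≢_; refl; cong; cong₂; subst; subst₂; setoid)
open import Relation.Nullary using (¬_; yes; no; contradiction)
open import Relation.Nullary.Decidable using (map′; _×-dec_)

module _ {A : Set} where
  open import Data.Nat using (suc; _+_; _≤_; _<_; z≤n; s≤s)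
  open import Data.Nat.Properties using (<⇒≱; +-suc)

  Unique-resp-↭ : Unique {A = A} Respects _↭_
  Unique-resp-↭ p = ↭ₛ.Unique-resp-↭ (setoid A) (↭⇒↭ₛ p)

  Unique-∷∷⁻ : ∀ {a b : A} {xs} → Unique (a ∷ b ∷ xs) → a ≢ b × a ∉ xs × b ∉ xs × Unique xs
  Unique-∷∷⁻ ((a≢b ∷ a≢xs) ∷ b≢xs ∷ u) =
    a≢b , (λ a∈xs → All.lookup a≢xs a∈xs refl) , (λ b∈xs → All.lookup b≢xs b∈xs refl) , u

  Unique-∷⁺ : ∀ {a : A} {xs} → a ∉ xs → Unique xs → Unique (a ∷ xs)
  Unique-∷⁺ a∉xs u = All.tabulate (λ x∈xs a≡x → a∉xs (subst (_∈ _) (≡.sym a≡x) x∈xs)) ∷ u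

  Unique-∷∷⁺ : ∀ {a b : A} {xs} → a ≢ b → a ∉ xs → b ∉ xs → Unique xs → Unique (a ∷ b ∷ xs)
  Unique-∷∷⁺ a≢b a∉xs b∉xs u =
    Unique-∷⁺ (λ { (here a≡b) → a≢b a≡b ; (there a∈xs) → a∉xs a∈xs }) (Unique-∷⁺ b∉xs u)

  Unique-⊆⇒length≤ : ∀ {xs ys : List A} → Unique xs → xs ⊆ ys → length xs ≤ length ys
  Unique-⊆⇒length≤ {[]} _ _ = z≤n
  Unique-⊆⇒length≤ {x ∷ xs} (x≢xs ∷ u) xs⊆ys with as , bs , refl ← ∈-∃++ (xs⊆ys (here refl)) =
    subst (suc (length xs) ≤_) (≡.sym (↭-length (shift x as bs))) (s≤s (Unique-⊆⇒length≤ u xs⊆as++bs))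
    where
    xs⊆as++bs : xs ⊆ as ++ bs
    xs⊆as++bs w∈xs with ∈-resp-↭ (shift x as bs) (xs⊆ys (there w∈xs))
    ... | here refl = contradiction refl (All.lookup x≢xs w∈xs)
    ... | there w∈as++bs = w∈as++bs

  module _ (_≟_ : DecidableEquality A) where
    open import Data.List.Membership.DecPropositional _≟_ using (_∈?_; find)

    ∃∉-of-length< : ∀ {xs ys : List A} → Unique ys → length xs < length ys → ∃[ y ] (y ∈ ys × y ∉ xs)
    ∃∉-of-length< {xs} {ys} u lt with All.all? (_∈? xs) ys
    ... | yes ys⊆xs = contradiction (Unique-⊆⇒length≤ u (All.lookup ys⊆xs)) (<⇒≱ lt)
    ... | no ys⊈xs = find (¬All⇒Any¬ (_∈? xs) ys ys⊈xs)

  pairsToList-++ : (ps qs : List (A × A)) → pairsToList (ps ++ qs) ≡ pairsToList ps ++ pairsToList qs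
  pairsToList-++ [] qs = refl
  pairsToList-++ ((a , b) ∷ ps) qs = cong (λ l → a ∷ b ∷ l) (pairsToList-++ ps qs)

  length-pairsToList : (ps : List (A × A)) → length (pairsToList ps) ≡ length ps + length ps
  length-pairsToList [] = refl
  length-pairsToList (_ ∷ ps) =
    cong suc (≡.trans (cong suc (length-pairsToList ps)) (≡.sym (+-suc (length ps) (length ps))))

  ∈-pairsToList⁺ˡ : ∀ {a b : A} {ps} → (a , b) ∈ ps → a ∈ pairsToList ps
  ∈-pairsToList⁺ˡ (here refl) = here refl
  ∈-pairsToList⁺ˡ {ps = _ ∷ _} (there m) = there (there (∈-pairsToList⁺ˡ m))

  ∈-pairsToList⁺ʳ : ∀ {a b : A} {ps} → (a , b) ∈ ps → b ∈ pairsToList ps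
  ∈-pairsToList⁺ʳ (here refl) = there (here refl)
  ∈-pairsToList⁺ʳ {ps = _ ∷ _} (there m) = there (there (∈-pairsToList⁺ʳ m))

module _ {A B : Set} where
  pairsToList-map : (f : A → B) (ps : List (A × A)) → pairsToList (map (Prod.map f f) ps) ≡ map f (pairsToList ps)
  pairsToList-map f [] = refl
  pairsToList-map f ((a , b) ∷ ps) = cong (λ l → f a ∷ f b ∷ l) (pairsToList-map f ps)

  pairsToList-map-<,> : (f g : A → B) (xs : List A) → pairsToList (map Prod.< f , g > xs) ↭ map f xs ++ map g xs
  pairsToList-map-<,> f g [] = refl
  pairsToList-map-<,> f g (x ∷ xs) =
    prep (f x) (trans (prep (g x) (pairsToList-map-<,> f g xs)) (↭-sym (shift (g x) (map f xs) (map g xs))))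

module Pairings {V : Set} (G : Graph V) (_≟_ : DecidableEquality V) where
  open import Data.Nat using (zero; suc; _+_; _∸_; _≤_; _<_; s≤s)
  open import Data.Nat.Properties
    using ( ≤-refl; ≤-reflexive; ≤-trans; ≤-antisym; _≤?_; <⇒≱; ≰⇒>; n≤1+n; m≤m+n; m+[n∸m]≡n
          ; +-suc; +-identityʳ; +-monoˡ-≤; +-monoʳ-≤; +-mono-≤; +-mono-<; even≢odd; module ≤-Reasoning)
  open import Data.List.Membership.DecPropositional _≟_ using (_∈?_; find)

  Close : V × V → Set
  Close (u , v) = Dist≤2 G u v

  Dist≤2-sym : ∀ {u v} → Dist≤2 G u v → Dist≤2 G v u
  Dist≤2-sym (inj₁ refl) = inj₁ refl
  Dist≤2-sym (inj₂ (inj₁ uv)) = inj₂ (inj₁ (sym G uv))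
  Dist≤2-sym (inj₂ (inj₂ (w , uw , wv))) = inj₂ (inj₂ (w , sym G wv , sym G uw))

  Dominates : List V → Set
  Dominates D = ∀ x → x ∈ D ⊎ ∃[ y ] (y ∈ D × Adj G x y)

  Dominates-⊆ : ∀ {D D′} → D ⊆ D′ → Dominates D → Dominates D′
  Dominates-⊆ D⊆D′ dom x with dom x
  ... | inj₁ x∈D = inj₁ (D⊆D′ x∈D)
  ... | inj₂ (y , y∈D , xy) = inj₂ (y , D⊆D′ y∈D , xy)

  record Pairing : Set where
    constructor pairing
    field
      pairs    : List (V × V)
      close    : All Close pairs
      distinct : Unique (pairsToList pairs)

    support : List V
    support = pairsToList pairs

    size : ℕ
    size = length pairs

  open Pairing public

  ∅ : Pairing
  ∅ = pairing [] [] []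

  length-support : (P : Pairing) → length (support P) ≡ size P + size P
  length-support P = length-pairsToList (pairs P)

  _⊑_ : Pairing → Pairing → Set
  P ⊑ Q = support P ⊆ support Q

  IsSPDS⇒Pairing : ∀ {D} → IsSPDS G D → ∃ λ P → support P ↭ D
  IsSPDS⇒Pairing spds with ps , cs , ps↭D ← IsSPDS.pairing spds =
    pairing ps cs (Unique-resp-↭ (↭-sym ps↭D) (IsSPDS.distinct spds)) , ps↭D

  Pairing⇒IsSPDS : (P : Pairing) → Dominates (support P) → IsSPDS G (support P)
  Pairing⇒IsSPDS P dom = record { distinct = distinct P ; dominating = dom ; pairing = pairs P , close P , refl }

  private
    removePair : ∀ {v} ps → All Close ps → v ∈ pairsToList ps →
      ∃₂ λ w ps′ → Close (v , w) × All Close ps′ ×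
                   pairsToList ps ↭ v ∷ w ∷ pairsToList ps′ × length ps ≡ suc (length ps′)
    removePair ((a , b) ∷ ps) (c ∷ cs) (here refl) = b , ps , c , cs , refl , refl
    removePair ((a , b) ∷ ps) (c ∷ cs) (there (here refl)) = a , ps , Dist≤2-sym c , cs , swap a b refl , refl
    removePair {v} ((a , b) ∷ ps) (c ∷ cs) (there (there v∈ps))
      with w , ps′ , vw , cs′ , ps↭ , len ← removePair ps cs v∈ps =
      w , (a , b) ∷ ps′ , vw , c ∷ cs′ ,
      trans (prep a (prep b ps↭)) (shifts (a ∷ b ∷ []) (v ∷ w ∷ [])) , cong suc len

  remove : ∀ {v} (P : Pairing) → v ∈ support P →
    ∃₂ λ w (P′ : Pairing) → Close (v , w) × support P ↭ v ∷ w ∷ support P′ × size P ≡ suc (size P′)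
  remove (pairing ps cs u) v∈P
    with w , ps′ , vw , cs′ , ps↭ , len ← removePair ps cs v∈P
    with _ , _ , _ , u′ ← Unique-∷∷⁻ (Unique-resp-↭ ps↭ u) =
    w , pairing ps′ cs′ u′ , vw , ps↭ , len

  private
    PairedIn : List (V × V) → V → V → Set
    PairedIn ps x y = (x , y) ∈ ps ⊎ (y , x) ∈ ps

    PairedIn⇒∈ : ∀ {x y ps} → PairedIn ps x y → x ∈ pairsToList ps
    PairedIn⇒∈ = [ ∈-pairsToList⁺ˡ , ∈-pairsToList⁺ʳ ]

    PairedIn-∷⁻ : ∀ {a b x y ps} → PairedIn ((a , b) ∷ ps) x y →
      (x ≡ a × y ≡ b) ⊎ (x ≡ b × y ≡ a) ⊎ PairedIn ps x y
    PairedIn-∷⁻ (inj₁ (here refl)) = inj₁ (refl , refl)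
    PairedIn-∷⁻ (inj₂ (here refl)) = inj₂ (inj₁ (refl , refl))
    PairedIn-∷⁻ (inj₁ (there m)) = inj₂ (inj₂ (inj₁ m))
    PairedIn-∷⁻ (inj₂ (there m)) = inj₂ (inj₂ (inj₂ m))

    PairedIn-≢ : ∀ {x y} ps → Unique (pairsToList ps) → PairedIn ps x y → x ≢ y
    PairedIn-≢ [] _ (inj₁ ())
    PairedIn-≢ [] _ (inj₂ ())
    PairedIn-≢ ((a , b) ∷ ps) u p with a≢b , _ , _ , u′ ← Unique-∷∷⁻ u with PairedIn-∷⁻ p
    ... | inj₁ (refl , refl) = a≢b
    ... | inj₂ (inj₁ (refl , refl)) = a≢b ∘ ≡.sym
    ... | inj₂ (inj₂ p′) = PairedIn-≢ ps u′ p′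

    PairedIn-unique : ∀ {x y y′} ps → Unique (pairsToList ps) → PairedIn ps x y → PairedIn ps x y′ → y ≡ y′
    PairedIn-unique [] _ (inj₁ ()) _
    PairedIn-unique [] _ (inj₂ ()) _
    PairedIn-unique ((a , b) ∷ ps) u p p′
      with a≢b , a∉ps , b∉ps , u′ ← Unique-∷∷⁻ u with PairedIn-∷⁻ p | PairedIn-∷⁻ p′
    ... | inj₁ (refl , refl)        | inj₁ (_ , refl)          = refl
    ... | inj₂ (inj₁ (refl , refl)) | inj₂ (inj₁ (_ , refl))   = refl
    ... | inj₁ (refl , _)           | inj₂ (inj₁ (a≡b , _))    = contradiction a≡b a≢b
    ... | inj₂ (inj₁ (refl , _))    | inj₁ (b≡a , _)           = contradiction (≡.sym b≡a) a≢b
    ... | inj₁ (refl , _)           | inj₂ (inj₂ q)            = contradiction (PairedIn⇒∈ q) a∉ps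
    ... | inj₂ (inj₁ (refl , _))    | inj₂ (inj₂ q)            = contradiction (PairedIn⇒∈ q) b∉ps
    ... | inj₂ (inj₂ q)             | inj₁ (refl , _)          = contradiction (PairedIn⇒∈ q) a∉ps
    ... | inj₂ (inj₂ q)             | inj₂ (inj₁ (refl , _))   = contradiction (PairedIn⇒∈ q) b∉ps
    ... | inj₂ (inj₂ q)             | inj₂ (inj₂ q′)           = PairedIn-unique ps u′ q q′

    partnerIn : ∀ {x} ps → x ∈ pairsToList ps → ∃ (PairedIn ps x)
    partnerIn ((a , b) ∷ ps) (here refl) = b , inj₁ (here refl)
    partnerIn ((a , b) ∷ ps) (there (here refl)) = a , inj₂ (here refl)
    partnerIn ((a , b) ∷ ps) (there (there x∈ps)) with y , p ← partnerIn ps x∈ps =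
      y , [ inj₁ ∘ there , inj₂ ∘ there ] p

  module Partnership (P : Pairing) where
    Partners : V → V → Set
    Partners = PairedIn (pairs P)

    partner : ∀ {x} → x ∈ support P → ∃ (Partners x)
    partner = partnerIn (pairs P)

    Partners-sym : ∀ {x y} → Partners x y → Partners y x
    Partners-sym = [ inj₂ , inj₁ ]

    Partners⇒∈ : ∀ {x y} → Partners x y → x ∈ support P
    Partners⇒∈ = PairedIn⇒∈

    Partners-close : ∀ {x y} → Partners x y → Dist≤2 G x y
    Partners-close = [ All.lookup (close P) , Dist≤2-sym ∘ All.lookup (close P) ]

    Partners-≢ : ∀ {x y} → Partners x y → x ≢ y
    Partners-≢ = PairedIn-≢ (pairs P) (distinct P)

    Partners-unique : ∀ {x y y′} → Partners x y → Partners x y′ → y ≡ y′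
    Partners-unique = PairedIn-unique (pairs P) (distinct P)

  private
    ∈-∷∷⁻ : ∀ {s a b : V} {xs} → s ∈ a ∷ b ∷ xs → s ≢ a → s ≢ b → s ∈ xs
    ∈-∷∷⁻ (here s≡a) s≢a _ = contradiction s≡a s≢a
    ∈-∷∷⁻ (there (here s≡b)) _ s≢b = contradiction s≡b s≢b
    ∈-∷∷⁻ (there (there s∈xs)) _ _ = s∈xs

    restrict : ∀ {Q P Q′ P″ : Pairing} {u x y} →
      support Q ↭ u ∷ x ∷ support Q′ → support P ↭ x ∷ y ∷ support P″ → P ⊑ Q → u ∉ support P →
      Unique (x ∷ y ∷ support P″) → P″ ⊑ Q′ × y ∈ support Q′ × y ∉ support P″
    restrict {Q′ = Q′} {P″} {u} {x} {y} Q↭ P↭ P⊑Q u∉P uP with x≢y , x∉P″ , y∉P″ , _ ← Unique-∷∷⁻ uP =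
      (λ s∈P″ → intoQ′ (there (there s∈P″)) (λ { refl → x∉P″ s∈P″ })) ,
      intoQ′ (there (here refl)) (λ y≡x → x≢y (≡.sym y≡x)) , y∉P″
      where
      intoQ′ : ∀ {s} → s ∈ x ∷ y ∷ support P″ → s ≢ x → s ∈ support Q′
      intoQ′ s∈ s≢x = ∈-∷∷⁻ (∈-resp-↭ Q↭ (P⊑Q (∈-resp-↭ (↭-sym P↭) s∈)))
                            (λ { refl → u∉P (∈-resp-↭ (↭-sym P↭) s∈) }) s≢x

    -- An alternating path: if u's partner x in Q is already used by P, pair x with u instead and look for a new
    -- partner for x's old partner y in the rest of Q.
    augmentPath : ∀ fuel (Q P : Pairing) → size P < fuel → P ⊑ Q → ∀ {u} → u ∈ support Q → u ∉ support P →
      ∃₂ λ e (P′ : Pairing) → e ∈ support Q × support P′ ↭ u ∷ e ∷ support P × size P′ ≡ suc (size P)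
    augmentPath (suc fuel) Q P (s≤s P<fuel) P⊑Q {u} u∈Q u∉P
      with x , Q′ , ux , Q↭ , _ ← remove Q u∈Q
      with u≢x , u∉Q′ , x∉Q′ , _ ← Unique-∷∷⁻ (Unique-resp-↭ Q↭ (distinct Q))
      with x ∈? support P
    ... | no x∉P =
      x , pairing ((u , x) ∷ pairs P) (ux ∷ close P) (Unique-∷∷⁺ u≢x u∉P x∉P (distinct P)) ,
      ∈-resp-↭ (↭-sym Q↭) (there (here refl)) , refl , refl
    ... | yes x∈P
      with y , P″ , _ , P↭ , P≡ ← remove P x∈P
      with P″⊑Q′ , y∈Q′ , y∉P″ ← restrict {Q} {P} {Q′} {P″} Q↭ P↭ P⊑Q u∉P (Unique-resp-↭ P↭ (distinct P))
      with e , P₃ , e∈Q′ , P₃↭ , P₃≡ ←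
             augmentPath fuel Q′ P″ (≤-trans (≤-reflexive (≡.sym P≡)) P<fuel) P″⊑Q′ y∈Q′ y∉P″ =
      e , pairing ((u , x) ∷ pairs P₃) (ux ∷ close P₃) (Unique-resp-↭ (↭-sym path↭) unique) ,
      ∈-resp-↭ (↭-sym Q↭) (there (there e∈Q′)) , path↭ , cong suc (≡.trans P₃≡ (≡.sym P≡))
      where
      path↭ : u ∷ x ∷ support P₃ ↭ u ∷ e ∷ support P
      path↭ = prep u (trans (prep x P₃↭) (trans (shifts (x ∷ y ∷ []) (e ∷ [])) (prep e (↭-sym P↭))))

      unique : Unique (u ∷ e ∷ support P)
      unique with y≢e , _ , e∉P″ , _ ← Unique-∷∷⁻ (Unique-resp-↭ P₃↭ (distinct P₃)) =
        Unique-∷∷⁺ (λ { refl → u∉Q′ e∈Q′ }) u∉P e∉P (distinct P)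
        where
        e∉P : e ∉ support P
        e∉P e∈P with ∈-resp-↭ P↭ e∈P
        ... | here refl = x∉Q′ e∈Q′
        ... | there (here refl) = y≢e refl
        ... | there (there e∈P″) = e∉P″ e∈P″

  augment : (Q P : Pairing) → P ⊑ Q → ∀ {u} → u ∈ support Q → u ∉ support P →
    ∃ λ P′ → P′ ⊑ Q × P ⊑ P′ × u ∈ support P′ × size P′ ≡ suc (size P)
  augment Q P P⊑Q u∈Q u∉P
    with e , P′ , e∈Q , P′↭ , P′≡ ← augmentPath (suc (size P)) Q P ≤-refl P⊑Q u∈Q u∉P =
    P′ , P′⊑Q , (λ s∈P → ∈-resp-↭ (↭-sym P′↭) (there (there s∈P))) ,
    ∈-resp-↭ (↭-sym P′↭) (here refl) , P′≡
    where
    P′⊑Q : P′ ⊑ Q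
    P′⊑Q s∈P′ with ∈-resp-↭ P′↭ s∈P′
    ... | here refl = u∈Q
    ... | there (here refl) = e∈Q
    ... | there (there s∈P) = P⊑Q s∈P

  include : (Q P : Pairing) → P ⊑ Q → ∀ {u} → u ∈ support Q →
    ∃ λ P′ → P′ ⊑ Q × P ⊑ P′ × u ∈ support P′ × size P′ ≤ suc (size P)
  include Q P P⊑Q {u} u∈Q with u ∈? support P
  ... | yes u∈P = P , P⊑Q , id , u∈P , n≤1+n (size P)
  ... | no u∉P with P′ , P′⊑Q , P⊑P′ , u∈P′ , P′≡ ← augment Q P P⊑Q u∈Q u∉P =
    P′ , P′⊑Q , P⊑P′ , u∈P′ , ≤-reflexive P′≡

  includePair : (Q P : Pairing) → P ⊑ Q → ∀ {x y} → Close (x , y) → x ∈ support Q → y ∈ support Q →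
    ∃ λ P′ → P′ ⊑ Q × P ⊑ P′ × x ∈ support P′ × y ∈ support P′ × size P′ ≤ suc (size P)
  includePair Q P P⊑Q {x} {y} xy x∈Q y∈Q with x ∈? support P | y ∈? support P
  ... | yes x∈P | _
    with P′ , P′⊑Q , P⊑P′ , y∈P′ , P′≤ ← include Q P P⊑Q y∈Q =
    P′ , P′⊑Q , P⊑P′ , P⊑P′ x∈P , y∈P′ , P′≤
  ... | no _ | yes y∈P
    with P′ , P′⊑Q , P⊑P′ , x∈P′ , P′≤ ← include Q P P⊑Q x∈Q =
    P′ , P′⊑Q , P⊑P′ , x∈P′ , P⊑P′ y∈P , P′≤
  ... | no x∉P | no y∉P with x ≟ y
  ... | yes refl
    with P′ , P′⊑Q , P⊑P′ , x∈P′ , P′≤ ← include Q P P⊑Q x∈Q =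
    P′ , P′⊑Q , P⊑P′ , x∈P′ , x∈P′ , P′≤
  ... | no x≢y =
    pairing ((x , y) ∷ pairs P) (xy ∷ close P) (Unique-∷∷⁺ x≢y x∉P y∉P (distinct P)) ,
    (λ { (here refl) → x∈Q ; (there (here refl)) → y∈Q ; (there (there s∈P)) → P⊑Q s∈P }) ,
    there ∘ there , here refl , there (here refl) , ≤-refl

  includeAll : (Q P : Pairing) → P ⊑ Q → (I : List (V × V)) → All Close I → pairsToList I ⊆ support Q →
    ∃ λ P′ → P′ ⊑ Q × P ⊑ P′ × pairsToList I ⊆ support P′ × size P′ ≤ size P + length I
  includeAll Q P P⊑Q [] [] _ = P , P⊑Q , id , (λ ()) , m≤m+n (size P) 0
  includeAll Q P P⊑Q ((x , y) ∷ I) (xy ∷ cI) I⊆Q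
    with P₁ , P₁⊑Q , P⊑P₁ , x∈P₁ , y∈P₁ , P₁≤ ←
           includePair Q P P⊑Q xy (I⊆Q (here refl)) (I⊆Q (there (here refl)))
    with P₂ , P₂⊑Q , P₁⊑P₂ , I⊆P₂ , P₂≤ ← includeAll Q P₁ P₁⊑Q I cI (I⊆Q ∘ there ∘ there) =
    P₂ , P₂⊑Q , P₁⊑P₂ ∘ P⊑P₁ ,
    (λ { (here refl) → P₁⊑P₂ x∈P₁
       ; (there (here refl)) → P₁⊑P₂ y∈P₁
       ; (there (there s∈I)) → I⊆P₂ s∈I }) ,
    ≤-trans P₂≤ (≤-trans (+-monoˡ-≤ (length I) P₁≤) (≤-reflexive (≡.sym (+-suc (size P) (length I)))))

  ∃∉-of-size< : ∀ {P Q} → size P < size Q → ∃[ u ] (u ∈ support Q × u ∉ support P)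
  ∃∉-of-size< {P} {Q} P<Q = ∃∉-of-length< _≟_ (distinct Q)
    (subst₂ _<_ (≡.sym (length-support P)) (≡.sym (length-support Q)) (+-mono-< P<Q P<Q))

  enlarge : (Q P : Pairing) → P ⊑ Q → ∀ j → size P + j ≤ size Q →
    ∃ λ P′ → P′ ⊑ Q × P ⊑ P′ × size P′ ≡ size P + j
  enlarge Q P P⊑Q zero _ = P , P⊑Q , id , ≡.sym (+-identityʳ (size P))
  enlarge Q P P⊑Q (suc j) P+1+j≤Q
    with P₁ , P₁⊑Q , P⊑P₁ , P₁≡ ← enlarge Q P P⊑Q j (≤-trans (+-monoʳ-≤ (size P) (n≤1+n j)) P+1+j≤Q)
    with u , u∈Q , u∉P₁ ← ∃∉-of-size< {P₁} {Q}
                            (subst (_≤ size Q) (≡.trans (+-suc (size P) j) (cong suc (≡.sym P₁≡))) P+1+j≤Q)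
    with P₂ , P₂⊑Q , P₁⊑P₂ , _ , P₂≡ ← augment Q P₁ P₁⊑Q u∈Q u∉P₁ =
    P₂ , P₂⊑Q , P₁⊑P₂ ∘ P⊑P₁ , ≡.trans P₂≡ (≡.trans (cong suc P₁≡) (≡.sym (+-suc (size P) j)))

  extend : (Q : Pairing) (I : List (V × V)) → All Close I → pairsToList I ⊆ support Q →
    ∀ {t} → length I ≤ t → t ≤ size Q → ∃ λ P → size P ≡ t × pairsToList I ⊆ support P
  extend Q I cI I⊆Q {t} I≤t t≤Q
    with P₁ , P₁⊑Q , _ , I⊆P₁ , P₁≤I ← includeAll Q ∅ (λ ()) I cI I⊆Q
    with P₂ , _ , P₁⊑P₂ , P₂≡ ← enlarge Q P₁ P₁⊑Q (t ∸ size P₁)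
                                 (subst (_≤ size Q) (≡.sym (m+[n∸m]≡n (≤-trans P₁≤I I≤t))) t≤Q) =
    P₂ , ≡.trans P₂≡ (m+[n∸m]≡n (≤-trans P₁≤I I≤t)) , P₁⊑P₂ ∘ I⊆P₁

  data Tree : Set where
    node : V → List Tree → Tree

  root : Tree → V
  root (node x _) = x

  children : Tree → List Tree
  children (node _ ts) = ts

  mutual
    vertices : Tree → List V
    vertices (node x ts) = x ∷ forestVertices ts

    forestVertices : List Tree → List V
    forestVertices [] = []
    forestVertices (t ∷ ts) = vertices t ++ forestVertices ts

  mutual
    IsTree : Tree → Set
    IsTree (node x ts) = Hanging x ts

    Hanging : V → List Tree → Set
    Hanging x [] = ⊤
    Hanging x (t ∷ ts) = Adj G (root t) x × IsTree t × Hanging x ts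

  private
    pairsToList-++-↭ʳ : ∀ (ps qs : List (V × V)) {ys} →
      pairsToList qs ↭ ys → pairsToList (ps ++ qs) ↭ pairsToList ps ++ ys
    pairsToList-++-↭ʳ ps qs qs↭ = subst (_↭ _) (≡.sym (pairsToList-++ ps qs)) (++⁺ˡ (pairsToList ps) qs↭)

    pairsToList-++-assoc : ∀ qs ps (R : List V) → pairsToList (qs ++ ps) ++ R ≡ pairsToList qs ++ pairsToList ps ++ R
    pairsToList-++-assoc qs ps R =
      ≡.trans (cong (_++ R) (pairsToList-++ qs ps)) (++-assoc (pairsToList qs) (pairsToList ps) R)

    -- Siblings are at distance ≤ 2 through their parent x, which pairs up a leftover odd one.
    pairSiblings : ∀ x R → All (λ r → Adj G r x) R →
      ∃ λ ps → All Close ps × (pairsToList ps ↭ R ⊎ pairsToList ps ↭ x ∷ R)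
    pairSiblings x [] [] = [] , [] , inj₁ refl
    pairSiblings x (r ∷ []) (rx ∷ []) = (r , x) ∷ [] , inj₂ (inj₁ rx) ∷ [] , inj₂ (swap r x refl)
    pairSiblings x (r₁ ∷ r₂ ∷ R) (r₁x ∷ r₂x ∷ Rx) with ps , cs , ps↭ ← pairSiblings x R Rx =
      (r₁ , r₂) ∷ ps , inj₂ (inj₂ (x , r₁x , sym G r₂x)) ∷ cs ,
      [ inj₁ ∘ prep r₁ ∘ prep r₂ , inj₂ ∘ extra ] ps↭
      where
      extra : pairsToList ps ↭ x ∷ R → r₁ ∷ r₂ ∷ pairsToList ps ↭ x ∷ r₁ ∷ r₂ ∷ R
      extra ps↭ = trans (prep r₁ (prep r₂ ps↭)) (shifts (r₁ ∷ r₂ ∷ []) (x ∷ []))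

  mutual
    pairTree : ∀ t → IsTree t →
      ∃ λ ps → All Close ps × (pairsToList ps ↭ vertices t ⊎ pairsToList ps ↭ forestVertices (children t))
    pairTree (node x ts) hang with pairForest x ts hang
    ... | R , ps , Rx , cs , ps++R↭ with pairSiblings x R Rx
    ... | qs , cs′ , inj₁ qs↭R =
      ps ++ qs , All-++⁺ cs cs′ , inj₂ (trans (pairsToList-++-↭ʳ ps qs qs↭R) ps++R↭)
    ... | qs , cs′ , inj₂ qs↭xR =
      ps ++ qs , All-++⁺ cs cs′ ,
      inj₁ (trans (pairsToList-++-↭ʳ ps qs qs↭xR) (trans (shift x _ R) (prep x ps++R↭)))

    pairForest : ∀ x ts → Hanging x ts →
      ∃₂ λ R ps → All (λ r → Adj G r x) R × All Close ps × pairsToList ps ++ R ↭ forestVertices ts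
    pairForest x [] _ = [] , [] , [] , [] , refl
    pairForest x (node r ks ∷ ts) (rx , tree , hang)
      with pairTree (node r ks) tree | pairForest x ts hang
    ... | qs , cs , inj₁ qs↭ | R , ps , Rx , cs′ , ps↭ =
      R , qs ++ ps , Rx , All-++⁺ cs cs′ , subst (_↭ _) (≡.sym (pairsToList-++-assoc qs ps R)) (++⁺ qs↭ ps↭)
    ... | qs , cs , inj₂ qs↭ | R , ps , Rx , cs′ , ps↭ =
      r ∷ R , qs ++ ps , rx ∷ Rx , All-++⁺ cs cs′ ,
      subst (_↭ _) (≡.sym (pairsToList-++-assoc qs ps (r ∷ R)))
        (trans (++⁺ˡ (pairsToList qs) (shift r (pairsToList ps) R))
          (trans (shift r (pairsToList qs) _) (prep r (++⁺ qs↭ ps↭))))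

  mutual
    graft : ∀ t {p} → IsTree t → p ∈ vertices t → ∀ y → Adj G y p →
      ∃ λ t′ → IsTree t′ × vertices t′ ↭ y ∷ vertices t × root t′ ≡ root t
    graft (node x ts) hang (here refl) y yx = node x (node y [] ∷ ts) , (yx , tt , hang) , swap x y refl , refl
    graft (node x ts) hang (there p∈ts) y yp with ts′ , hang′ , ts′↭ ← graftForest x ts hang p∈ts y yp =
      node x ts′ , hang′ , trans (prep x ts′↭) (swap x y refl) , refl

    graftForest : ∀ x ts {p} → Hanging x ts → p ∈ forestVertices ts → ∀ y → Adj G y p →
      ∃ λ ts′ → Hanging x ts′ × forestVertices ts′ ↭ y ∷ forestVertices ts
    graftForest x (t ∷ ts) (tx , tree , hang) p∈ y yp with ∈-++⁻ (vertices t) p∈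
    ... | inj₁ p∈t with t′ , tree′ , t′↭ , root≡ ← graft t tree p∈t y yp =
      t′ ∷ ts , (subst (λ r → Adj G r x) (≡.sym root≡) tx , tree′ , hang) , ++⁺ʳ (forestVertices ts) t′↭
    ... | inj₂ p∈ts with ts′ , hang′ , ts′↭ ← graftForest x ts hang p∈ts y yp =
      t ∷ ts′ , (tx , tree , hang′) , trans (++⁺ˡ (vertices t) ts′↭) (shift y (vertices t) (forestVertices ts))

  root∈vertices : ∀ t → root t ∈ vertices t
  root∈vertices (node _ _) = here refl

  SpanningTree : V → List V → Set
  SpanningTree z vs = ∃ λ t → IsTree t × Unique (vertices t) × root t ≡ z × vs ⊆ vertices t

  private
    extendAlong : ∀ t → IsTree t → Unique (vertices t) → ∀ {x v} → x ∈ vertices t → Star (Adj G) x v →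
      ∃ λ t′ → IsTree t′ × Unique (vertices t′) × root t′ ≡ root t ×
               v ∈ vertices t′ × vertices t ⊆ vertices t′
    extendAlong t tree u x∈t ε = t , tree , u , refl , x∈t , id
    extendAlong t tree u x∈t (_◅_ {j = y} xy y↝v) with y ∈? vertices t
    ... | yes y∈t = extendAlong t tree u y∈t y↝v
    ... | no y∉t
      with t₁ , tree₁ , t₁↭ , root₁ ← graft t tree x∈t y (sym G xy)
      with t₂ , tree₂ , u₂ , root₂ , v∈t₂ , t₁⊆t₂ ←
             extendAlong t₁ tree₁ (Unique-resp-↭ (↭-sym t₁↭) (Unique-∷⁺ y∉t u))
                         (∈-resp-↭ (↭-sym t₁↭) (here refl)) y↝v =
      t₂ , tree₂ , u₂ , ≡.trans root₂ root₁ , v∈t₂ , t₁⊆t₂ ∘ ∈-resp-↭ (↭-sym t₁↭) ∘ there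

  spanningTree : Connected G → ∀ z vs → SpanningTree z vs
  spanningTree conn z [] = node z [] , tt , [] ∷ [] , refl , λ ()
  spanningTree conn z (v ∷ vs)
    with t , tree , u , refl , vs⊆t ← spanningTree conn z vs
    with t′ , tree′ , u′ , root≡ , v∈t′ , t⊆t′ ← extendAlong t tree u (root∈vertices t) (conn (root t) v) =
    t′ , tree′ , u′ , root≡ , λ { (here refl) → v∈t′ ; (there w∈vs) → t⊆t′ (vs⊆t w∈vs) }

  nearPerfectPairing : Connected G → ∀ z vs → ∃ λ Q → ∀ {v} → v ∈ vs → v ≢ z → v ∈ support Q
  nearPerfectPairing conn z vs
    with node x ts , tree , u , refl , vs⊆t ← spanningTree conn z vs with pairTree (node x ts) tree
  ... | ps , cs , inj₁ ps↭ =
    pairing ps cs (Unique-resp-↭ (↭-sym ps↭) u) , λ v∈vs _ → ∈-resp-↭ (↭-sym ps↭) (vs⊆t v∈vs)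
  ... | ps , cs , inj₂ ps↭ with _ ∷ uts ← u = pairing ps cs (Unique-resp-↭ (↭-sym ps↭) uts) , covered
    where
    covered : ∀ {v} → v ∈ vs → v ≢ x → v ∈ pairsToList ps
    covered v∈vs v≢x with vs⊆t v∈vs
    ... | here v≡x = contradiction v≡x v≢x
    ... | there v∈ts = ∈-resp-↭ (↭-sym ps↭) v∈ts

  private
    half-≤ : ∀ {t q} → t + t ≤ suc (q + q) → t ≤ q
    half-≤ {t} {q} h with t ≤? q
    ... | yes t≤q = t≤q
    ... | no t≰q =
      contradiction h (<⇒≱ (subst (_≤ t + t) (cong suc (+-suc q q)) (+-mono-≤ (≰⇒> t≰q) (≰⇒> t≰q))))

    even≢odd′ : ∀ t q → t + t ≢ suc (q + q)
    even≢odd′ t q eq =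
      even≢odd t q (subst₂ (λ a b → t + a ≡ suc (q + b)) (≡.sym (+-identityʳ t)) (≡.sym (+-identityʳ q)) eq)

    length≤1+support : ∀ {vs z} (Q : Pairing) → Unique vs → (∀ {v} → v ∈ vs → v ≢ z → v ∈ support Q) →
      length vs ≤ suc (size Q + size Q)
    length≤1+support {vs} {z} Q uvs Q-covers =
      subst (length vs ≤_) (cong suc (length-support Q)) (Unique-⊆⇒length≤ uvs vs⊆z∷Q)
      where
      vs⊆z∷Q : vs ⊆ z ∷ support Q
      vs⊆z∷Q {v} v∈vs with v ≟ z
      ... | yes v≡z = here v≡z
      ... | no v≢z = there (Q-covers v∈vs v≢z)

    rootOutside : V → ∀ vs → (∀ v → v ∈ vs) → ∀ xs → ∃[ z ] (z ∉ xs ⊎ (∀ v → v ∈ xs))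
    rootOutside v₀ vs all∈vs xs with All.all? (_∈? xs) vs
    ... | yes covered = v₀ , inj₂ (λ v → All.lookup covered (all∈vs v))
    ... | no ¬covered with z , _ , z∉xs ← find (¬All⇒Any¬ (_∈? xs) vs ¬covered) = z , inj₁ z∉xs

  -- The near-perfect pairing is rooted outside the vertices of I when possible (otherwise at v₀); if I covers every
  -- vertex, the vertex count is even, so the near-perfect pairing leaves no vertex out.
  pairingOfSize : Connected G → (vs : List V) → Unique vs → (∀ v → v ∈ vs) → V →
    (I : List (V × V)) → All Close I → ∀ {t} → length I ≤ t → t + t ≤ length vs →
    ∃ λ P → size P ≡ t × pairsToList I ⊆ support P
  pairingOfSize conn vs uvs all∈vs v₀ I cI {t} I≤t 2t≤vs
    with z , z∉I⊎I-covers ← rootOutside v₀ vs all∈vs (pairsToList I)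
    with Q , Q-covers ← nearPerfectPairing conn z vs
    with 2t≤1+2q ← ≤-trans 2t≤vs (length≤1+support Q uvs Q-covers)
    with z ∈? support Q | z∉I⊎I-covers
  ... | yes z∈Q | _ = extend Q I cI I⊆Q I≤t (half-≤ 2t≤1+2q)
    where
    I⊆Q : pairsToList I ⊆ support Q
    I⊆Q {v} _ with v ≟ z
    ... | yes refl = z∈Q
    ... | no v≢z = Q-covers (all∈vs v) v≢z
  ... | no _ | inj₁ z∉I =
    extend Q I cI (λ {v} v∈I → Q-covers (all∈vs v) (λ { refl → z∉I v∈I })) I≤t (half-≤ 2t≤1+2q)
  ... | no z∉Q | inj₂ I-covers = contradiction (≤-antisym 2t≤1+2q 1+2q≤2t) (even≢odd′ t (size Q))
    where
    1+2q≤2t : suc (size Q + size Q) ≤ t + t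
    1+2q≤2t = begin
      suc (size Q + size Q)         ≡⟨ cong suc (length-support Q) ⟨
      length (z ∷ support Q)        ≤⟨ Unique-⊆⇒length≤ (Unique-∷⁺ z∉Q (distinct Q)) (λ {v} _ → all∈vs v) ⟩
      length vs                     ≤⟨ Unique-⊆⇒length≤ uvs (λ {v} _ → I-covers v) ⟩
      length (pairsToList I)        ≡⟨ length-pairsToList I ⟩
      length I + length I           ≤⟨ +-mono-≤ I≤t I≤t ⟩
      t + t                         ∎
      where open ≤-Reasoning

module GP5Properties {n : ℕ} (H : Graph (Fin n)) where
  open import Data.Nat using (suc; _+_; _*_; _∸_; _≤_)
  open import Data.Nat.Properties
    using (+-comm; +-suc; +-monoʳ-≤; +-cancelˡ-≤; ≤-trans; m≤m+n; m+[n∸m]≡n; module ≤-Reasoning)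
  open import Data.Nat.Tactic.RingSolver using (solve-∀)
  open import Data.Integer.Properties using (drop‿+≤+; +-0-abelianGroup)
  open import Algebra.Bundles using (AbelianGroup)
  open import Algebra.Properties.Group (AbelianGroup.group +-0-abelianGroup) using (∙-cancelˡ)

  index : GV n → Fin n
  index (vv i) = i
  index (aa i) = i
  index (bb i) = i
  index (cc i) = i
  index (dd i) = i
  index (ee i) = i

  private
    tag : GV n → ℕ
    tag (vv _) = 0
    tag (aa _) = 1
    tag (bb _) = 2
    tag (cc _) = 3
    tag (dd _) = 4
    tag (ee _) = 5

    untag : ℕ → Fin n → GV n
    untag 0 = vv
    untag 1 = aa
    untag 2 = bb
    untag 3 = cc
    untag 4 = dd
    untag _ = ee

    untag-tag : ∀ x → untag (tag x) (index x) ≡ x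
    untag-tag (vv _) = refl
    untag-tag (aa _) = refl
    untag-tag (bb _) = refl
    untag-tag (cc _) = refl
    untag-tag (dd _) = refl
    untag-tag (ee _) = refl

  _≟_ : DecidableEquality (GV n)
  x ≟ y = map′ (λ (t≡ , i≡) → ≡.trans (≡.sym (untag-tag x)) (≡.trans (cong₂ untag t≡ i≡) (untag-tag y)))
               (λ { refl → refl , refl }) (tag x ℕ.≟ tag y ×-dec index x Fin.≟ index y)

  module InH = Pairings H Fin._≟_
  module InG = Pairings (GP5 H) _≟_
  open InG using (pairing; pairs; support; size)

  private
    twice-+ : ∀ m k → (m + k) + (m + k) ≡ 2 * m + (k + k)
    twice-+ = solve-∀

  lift-Dist≤2 : ∀ {u v} → Dist≤2 H u v → Dist≤2 (GP5 H) (vv u) (vv v)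
  lift-Dist≤2 (inj₁ refl) = inj₁ refl
  lift-Dist≤2 (inj₂ (inj₁ uv)) = inj₂ (inj₁ (hE uv))
  lift-Dist≤2 (inj₂ (inj₂ (w , uw , wv))) = inj₂ (inj₂ (vv w , hE uw , hE wv))

  private
    map-disjoint : ∀ {f g : Fin n → GV n} {is js} → (∀ {i j} → f i ≢ g j) → Disjoint (map f is) (map g js)
    map-disjoint {f} {g} f≢g (x∈fis , x∈gjs)
      with _ , _ , refl ← ∈-map⁻ f x∈fis with _ , _ , eq ← ∈-map⁻ g x∈gjs = f≢g eq

    gadgetVertices : List (GV n)
    gadgetVertices = map bb (allFin n) ++ map dd (allFin n)

    unique-lifted : ∀ {S} → Unique S → Unique (map vv S ++ gadgetVertices)
    unique-lifted uS = Unique.++⁺ (Unique.map⁺ (λ { refl → refl }) uS)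
      (Unique.++⁺ (Unique.map⁺ (λ { refl → refl }) (Unique.allFin⁺ n))
                  (Unique.map⁺ (λ { refl → refl }) (Unique.allFin⁺ n)) (map-disjoint λ ()))
      (λ (x∈vv , x∈gadget) → [ (λ x∈bb → map-disjoint (λ ()) (x∈vv , x∈bb))
                             , (λ x∈dd → map-disjoint (λ ()) (x∈vv , x∈dd)) ]
                               (∈-++⁻ (map bb (allFin n)) x∈gadget))

    liftPairs : List (Fin n × Fin n) → List (GV n × GV n)
    liftPairs ps = map (Prod.map vv vv) ps ++ map Prod.< bb , dd > (allFin n)

    support-liftPairs : ∀ ps → pairsToList (liftPairs ps) ↭ map vv (pairsToList ps) ++ gadgetVertices
    support-liftPairs ps =
      subst (_↭ map vv (pairsToList ps) ++ gadgetVertices)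
        (≡.sym (≡.trans (pairsToList-++ (map (Prod.map vv vv) ps) _) (cong (_++ _) (pairsToList-map vv ps))))
        (++⁺ˡ (map vv (pairsToList ps)) (pairsToList-map-<,> bb dd (allFin n)))

  lift : InH.Pairing → InG.Pairing
  lift (pairing ps cs u) = pairing (liftPairs ps) (All-++⁺ (lift-close cs) (gadget-close (allFin n)))
    (Unique-resp-↭ (↭-sym (support-liftPairs ps)) (unique-lifted u))
    where
    lift-close : ∀ {ps} → All InH.Close ps → All InG.Close (map (Prod.map vv vv) ps)
    lift-close [] = []
    lift-close (c ∷ cs) = lift-Dist≤2 c ∷ lift-close cs
    gadget-close : ∀ is → All InG.Close (map Prod.< bb , dd > is)
    gadget-close [] = []
    gadget-close (i ∷ is) = inj₂ (inj₂ (cc i , bc , cd)) ∷ gadget-close is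

  private
    ∈-lift : ∀ P {x} → x ∈ map vv (InH.support P) ++ gadgetVertices → x ∈ support (lift P)
    ∈-lift (pairing ps _ _) = ∈-resp-↭ (↭-sym (support-liftPairs ps))

    b∈lift : ∀ P i → bb i ∈ support (lift P)
    b∈lift P i = ∈-lift P (∈-++⁺ʳ (map vv (InH.support P)) (∈-++⁺ˡ (∈-map⁺ bb (∈-allFin i))))

    d∈lift : ∀ P i → dd i ∈ support (lift P)
    d∈lift P i =
      ∈-lift P (∈-++⁺ʳ (map vv (InH.support P)) (∈-++⁺ʳ (map bb (allFin n)) (∈-map⁺ dd (∈-allFin i))))

    v∈lift : ∀ P {w} → w ∈ InH.support P → vv w ∈ support (lift P)
    v∈lift P w∈P = ∈-lift P (∈-++⁺ˡ (∈-map⁺ vv w∈P))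

  dominates-lift : ∀ P → InH.Dominates (InH.support P) → InG.Dominates (support (lift P))
  dominates-lift P dom (vv w) with dom w
  ... | inj₁ w∈P = inj₁ (v∈lift P w∈P)
  ... | inj₂ (u , u∈P , wu) = inj₂ (vv u , v∈lift P u∈P , hE wu)
  dominates-lift P dom (aa i) = inj₂ (bb i , b∈lift P i , ab)
  dominates-lift P dom (bb i) = inj₁ (b∈lift P i)
  dominates-lift P dom (cc i) = inj₂ (bb i , b∈lift P i , cb)
  dominates-lift P dom (dd i) = inj₁ (d∈lift P i)
  dominates-lift P dom (ee i) = inj₂ (dd i , d∈lift P i , ed)

  size-lift : ∀ P → size (lift P) ≡ n + InH.size P
  size-lift (pairing ps _ _) = begin
    length (liftPairs ps)
      ≡⟨ length-++ (map (Prod.map vv vv) ps) ⟩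
    length (map (Prod.map vv vv) ps) + length (map Prod.< bb , dd > (allFin n))
      ≡⟨ cong₂ _+_ (length-map _ ps) (≡.trans (length-map _ (allFin n)) (length-tabulate id)) ⟩
    length ps + n
      ≡⟨ +-comm (length ps) n ⟩
    n + length ps ∎
    where open ≡.≡-Reasoning

  length-lift : ∀ P → length (support (lift P)) ≡ 2 * n + length (InH.support P)
  length-lift P = begin
    length (support (lift P))                    ≡⟨ InG.length-support (lift P) ⟩
    size (lift P) + size (lift P)                ≡⟨ cong₂ _+_ (size-lift P) (size-lift P) ⟩
    (n + InH.size P) + (n + InH.size P)          ≡⟨ twice-+ n (InH.size P) ⟩
    2 * n + (InH.size P + InH.size P)            ≡⟨ cong (λ m → 2 * n + m) (InH.length-support P) ⟨
    2 * n + length (InH.support P)               ∎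
    where open ≡.≡-Reasoning

  lift-SPDS : ∀ {k} → HasSPDSOfSize H k → HasSPDSOfSize (GP5 H) (+ (2 * n) ℤ.+ k)
  lift-SPDS (D , spds , refl) with P , P↭D ← InH.IsSPDS⇒Pairing spds =
    support (lift P) ,
    InG.Pairing⇒IsSPDS (lift P)
      (dominates-lift P (InH.Dominates-⊆ (∈-resp-↭ (↭-sym P↭D)) (IsSPDS.dominating spds))) ,
    cong +_ (≡.trans (length-lift P) (cong (λ m → 2 * n + m) (↭-length P↭D)))

  vv-Dist≤2⁻ : ∀ {i j} → Dist≤2 (GP5 H) (vv i) (vv j) → Dist≤2 H i j
  vv-Dist≤2⁻ (inj₁ refl) = inj₁ refl
  vv-Dist≤2⁻ (inj₂ (inj₁ (hE ij))) = inj₂ (inj₁ ij)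
  vv-Dist≤2⁻ (inj₂ (inj₂ (vv w , hE iw , hE wj))) = inj₂ (inj₂ (w , iw , wj))
  vv-Dist≤2⁻ (inj₂ (inj₂ (cc w , vc , cv))) = inj₁ refl

  vc-Dist≤2⁻ : ∀ {i j} → Dist≤2 (GP5 H) (vv i) (cc j) → Dist≤2 H i j
  vc-Dist≤2⁻ (inj₂ (inj₁ vc)) = inj₁ refl
  vc-Dist≤2⁻ (inj₂ (inj₂ (vv w , hE iw , vc))) = inj₂ (inj₁ iw)

  cc-Dist≤2⁻ : ∀ {i j} → Dist≤2 (GP5 H) (cc i) (cc j) → Dist≤2 H i j
  cc-Dist≤2⁻ (inj₁ refl) = inj₁ refl
  cc-Dist≤2⁻ (inj₂ (inj₂ (_ , cv , vc))) = inj₁ refl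
  cc-Dist≤2⁻ (inj₂ (inj₂ (_ , cb , bc))) = inj₁ refl
  cc-Dist≤2⁻ (inj₂ (inj₂ (_ , cd , dc))) = inj₁ refl

  aa-Dist≤2⁻ : ∀ {i y} → Dist≤2 (GP5 H) (aa i) y → aa i ≢ y → y ≡ bb i ⊎ y ≡ cc i
  aa-Dist≤2⁻ (inj₁ a≡y) a≢y = contradiction a≡y a≢y
  aa-Dist≤2⁻ (inj₂ (inj₁ ab)) _ = inj₁ refl
  aa-Dist≤2⁻ (inj₂ (inj₂ (_ , ab , ba))) a≢a = contradiction refl a≢a
  aa-Dist≤2⁻ (inj₂ (inj₂ (_ , ab , bc))) _ = inj₂ refl

  bb-Dist≤2⁻ : ∀ {i y} → Dist≤2 (GP5 H) (bb i) y → bb i ≢ y →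
    y ≡ aa i ⊎ y ≡ cc i ⊎ y ≡ vv i ⊎ y ≡ dd i
  bb-Dist≤2⁻ (inj₁ b≡y) b≢y = contradiction b≡y b≢y
  bb-Dist≤2⁻ (inj₂ (inj₁ ba)) _ = inj₁ refl
  bb-Dist≤2⁻ (inj₂ (inj₁ bc)) _ = inj₂ (inj₁ refl)
  bb-Dist≤2⁻ (inj₂ (inj₂ (_ , ba , ab))) b≢b = contradiction refl b≢b
  bb-Dist≤2⁻ (inj₂ (inj₂ (_ , bc , cv))) _ = inj₂ (inj₂ (inj₁ refl))
  bb-Dist≤2⁻ (inj₂ (inj₂ (_ , bc , cb))) b≢b = contradiction refl b≢b
  bb-Dist≤2⁻ (inj₂ (inj₂ (_ , bc , cd))) _ = inj₂ (inj₂ (inj₂ refl))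

  dd-Dist≤2⁻ : ∀ {i y} → Dist≤2 (GP5 H) (dd i) y → dd i ≢ y →
    y ≡ ee i ⊎ y ≡ cc i ⊎ y ≡ vv i ⊎ y ≡ bb i
  dd-Dist≤2⁻ (inj₁ d≡y) d≢y = contradiction d≡y d≢y
  dd-Dist≤2⁻ (inj₂ (inj₁ de)) _ = inj₁ refl
  dd-Dist≤2⁻ (inj₂ (inj₁ dc)) _ = inj₂ (inj₁ refl)
  dd-Dist≤2⁻ (inj₂ (inj₂ (_ , de , ed))) d≢d = contradiction refl d≢d
  dd-Dist≤2⁻ (inj₂ (inj₂ (_ , dc , cv))) _ = inj₂ (inj₂ (inj₁ refl))
  dd-Dist≤2⁻ (inj₂ (inj₂ (_ , dc , cb))) _ = inj₂ (inj₂ (inj₂ refl))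
  dd-Dist≤2⁻ (inj₂ (inj₂ (_ , dc , cd))) d≢d = contradiction refl d≢d

  ee-Dist≤2⁻ : ∀ {i y} → Dist≤2 (GP5 H) (ee i) y → ee i ≢ y → y ≡ dd i ⊎ y ≡ cc i
  ee-Dist≤2⁻ (inj₁ e≡y) e≢y = contradiction e≡y e≢y
  ee-Dist≤2⁻ (inj₂ (inj₁ ed)) _ = inj₁ refl
  ee-Dist≤2⁻ (inj₂ (inj₂ (_ , ed , de))) e≢e = contradiction refl e≢e
  ee-Dist≤2⁻ (inj₂ (inj₂ (_ , ed , dc))) _ = inj₂ refl

  data Role : Set where
    original centre outer : Role

  role : GV n → Role
  role (vv _) = original
  role (cc _) = centre
  role (aa _) = outer
  role (bb _) = outer
  role (dd _) = outer
  role (ee _) = outer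

  module Projection (D : List (GV n)) where
    open import Data.List.Membership.DecPropositional _≟_ using (_∈?_)

    -- c i is needed in H only to dominate v i, and only when v i ∉ D.
    centreTrace : Fin n → Maybe (Fin n × Fin n)
    centreTrace i with vv i ∈? D
    ... | yes _ = nothing
    ... | no _ = just (i , i)

    traceRoles : Role → Role → Fin n → Fin n → Maybe (Fin n × Fin n)
    traceRoles original original i j = just (i , j)
    traceRoles original centre   i j = just (i , j)
    traceRoles centre   original i j = just (i , j)
    traceRoles centre   centre   i j = just (i , j)
    traceRoles original outer    i j = just (i , i)
    traceRoles outer    original i j = just (j , j)
    traceRoles centre   outer    i j = centreTrace i
    traceRoles outer    centre   i j = centreTrace j
    traceRoles outer    outer    i j = nothing

    trace : GV n × GV n → Maybe (Fin n × Fin n)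
    trace (x , y) = traceRoles (role x) (role y) (index x) (index y)

    centreTrace-∈ : ∀ {i} → vv i ∈ D → centreTrace i ≡ nothing
    centreTrace-∈ {i} v∈D with vv i ∈? D
    ... | yes _ = refl
    ... | no v∉D = contradiction v∈D v∉D

    centreTrace-∉ : ∀ {i} → vv i ∉ D → centreTrace i ≡ just (i , i)
    centreTrace-∉ {i} v∉D with vv i ∈? D
    ... | yes v∈D = contradiction v∈D v∉D
    ... | no _ = refl

    centreTrace-close : ∀ i → Maybe.All InH.Close (centreTrace i)
    centreTrace-close i with vv i ∈? D
    ... | yes _ = nothing
    ... | no _ = just (inj₁ refl)

    outer-close : ∀ {i} r j → Maybe.All InH.Close (traceRoles outer r i j)
    outer-close original j = just (inj₁ refl)
    outer-close centre j = centreTrace-close j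
    outer-close outer j = nothing

    trace-close : ∀ x y → Dist≤2 (GP5 H) x y → Maybe.All InH.Close (trace (x , y))
    trace-close (vv i) (vv j) d = just (vv-Dist≤2⁻ d)
    trace-close (vv i) (cc j) d = just (vc-Dist≤2⁻ d)
    trace-close (cc i) (vv j) d = just (InH.Dist≤2-sym (vc-Dist≤2⁻ (InG.Dist≤2-sym d)))
    trace-close (cc i) (cc j) d = just (cc-Dist≤2⁻ d)
    trace-close (vv i) (aa j) _ = just (inj₁ refl)
    trace-close (vv i) (bb j) _ = just (inj₁ refl)
    trace-close (vv i) (dd j) _ = just (inj₁ refl)
    trace-close (vv i) (ee j) _ = just (inj₁ refl)
    trace-close (cc i) (aa j) _ = centreTrace-close i
    trace-close (cc i) (bb j) _ = centreTrace-close i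
    trace-close (cc i) (dd j) _ = centreTrace-close i
    trace-close (cc i) (ee j) _ = centreTrace-close i
    trace-close (aa i) y _ = outer-close (role y) (index y)
    trace-close (bb i) y _ = outer-close (role y) (index y)
    trace-close (dd i) y _ = outer-close (role y) (index y)
    trace-close (ee i) y _ = outer-close (role y) (index y)

    traces : List (GV n × GV n) → List (Fin n × Fin n)
    traces [] = []
    traces (p ∷ ps) with trace p
    ... | just q = q ∷ traces ps
    ... | nothing = traces ps

    silent : List (GV n × GV n) → List (Fin n)
    silent [] = []
    silent (p ∷ ps) with trace p
    ... | just _ = silent ps
    ... | nothing = index (proj₁ p) ∷ silent ps

    length-traces+silent : ∀ ps → length ps ≡ length (traces ps) + length (silent ps)
    length-traces+silent [] = refl
    length-traces+silent (p ∷ ps) with trace p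
    ... | just _ = cong suc (length-traces+silent ps)
    ... | nothing = ≡.trans (cong suc (length-traces+silent ps)) (≡.sym (+-suc _ _))

    traces-close : ∀ {ps} → All InG.Close ps → All InH.Close (traces ps)
    traces-close [] = []
    traces-close {(x , y) ∷ _} (c ∷ cs) with trace (x , y) | trace-close x y c
    ... | just _ | just c′ = c′ ∷ traces-close cs
    ... | nothing | _ = traces-close cs

    ∈-traces : ∀ {p q ps} → p ∈ ps → trace p ≡ just q → q ∈ traces ps
    ∈-traces {ps = p ∷ _} (here refl) eq rewrite eq = here refl
    ∈-traces {ps = p ∷ _} (there p∈ps) eq with trace p
    ... | just _ = there (∈-traces p∈ps eq)
    ... | nothing = ∈-traces p∈ps eq

    ∈-silent : ∀ {p ps} → p ∈ ps → trace p ≡ nothing → index (proj₁ p) ∈ silent ps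
    ∈-silent {ps = p ∷ _} (here refl) eq rewrite eq = here refl
    ∈-silent {ps = p ∷ _} (there p∈ps) eq with trace p
    ... | just _ = ∈-silent p∈ps eq
    ... | nothing = there (∈-silent p∈ps eq)

    data Counted : GV n → Set where
      original : ∀ {i} → Counted (vv i)
      centre   : ∀ {i} → vv i ∉ D → Counted (cc i)

    trace-left : ∀ {x} → Counted x → ∀ y → ∃[ j ] (trace (x , y) ≡ just (index x , j))
    trace-left original (vv j) = j , refl
    trace-left original (cc j) = j , refl
    trace-left original (aa _) = _ , refl
    trace-left original (bb _) = _ , refl
    trace-left original (dd _) = _ , refl
    trace-left original (ee _) = _ , refl
    trace-left (centre v∉D) (vv j) = j , refl
    trace-left (centre v∉D) (cc j) = j , refl
    trace-left (centre v∉D) (aa _) = _ , centreTrace-∉ v∉D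
    trace-left (centre v∉D) (bb _) = _ , centreTrace-∉ v∉D
    trace-left (centre v∉D) (dd _) = _ , centreTrace-∉ v∉D
    trace-left (centre v∉D) (ee _) = _ , centreTrace-∉ v∉D

    trace-right : ∀ {x} → Counted x → ∀ y → ∃[ j ] (trace (y , x) ≡ just (j , index x))
    trace-right original (vv j) = j , refl
    trace-right original (cc j) = j , refl
    trace-right original (aa _) = _ , refl
    trace-right original (bb _) = _ , refl
    trace-right original (dd _) = _ , refl
    trace-right original (ee _) = _ , refl
    trace-right (centre v∉D) (vv j) = j , refl
    trace-right (centre v∉D) (cc j) = j , refl
    trace-right (centre v∉D) (aa _) = _ , centreTrace-∉ v∉D
    trace-right (centre v∉D) (bb _) = _ , centreTrace-∉ v∉D
    trace-right (centre v∉D) (dd _) = _ , centreTrace-∉ v∉D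
    trace-right (centre v∉D) (ee _) = _ , centreTrace-∉ v∉D

  module Backward (P : InG.Pairing) (dom : InG.Dominates (support P)) where
    open Projection (support P)
    open import Data.List.Membership.DecPropositional _≟_ using (_∈?_)
    open InG.Partnership P

    traced : ∀ {x y} → Partners x y → Counted x → index x ∈ pairsToList (traces (pairs P))
    traced {x} {y} (inj₁ xy∈P) cx with j , eq ← trace-left cx y = ∈-pairsToList⁺ˡ (∈-traces xy∈P eq)
    traced {x} {y} (inj₂ yx∈P) cx with j , eq ← trace-right cx y = ∈-pairsToList⁺ʳ (∈-traces yx∈P eq)

    traces-dominate : InH.Dominates (pairsToList (traces (pairs P)))
    traces-dominate w with vv w ∈? support P
    ... | yes v∈P = inj₁ (traced (proj₂ (partner v∈P)) original)
    ... | no v∉P with dom (vv w)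
    ... | inj₁ v∈P = contradiction v∈P v∉P
    ... | inj₂ (vv m , m∈P , hE wm) = inj₂ (m , traced (proj₂ (partner m∈P)) original , wm)
    ... | inj₂ (cc _ , c∈P , vc) = inj₁ (traced (proj₂ (partner c∈P)) (centre v∉P))

    silentPair : ∀ {x y i} → Partners x y → trace (x , y) ≡ nothing → trace (y , x) ≡ nothing →
      index x ≡ i → index y ≡ i → i ∈ silent (pairs P)
    silentPair (inj₁ xy∈P) eq _ refl _ = ∈-silent xy∈P eq
    silentPair (inj₂ yx∈P) _ eq _ refl = ∈-silent yx∈P eq

    private
      silentCentre : ∀ {x y i} → Partners x y → vv i ∈ support P → trace (x , y) ≡ centreTrace i →
        trace (y , x) ≡ centreTrace i → index x ≡ i → index y ≡ i → i ∈ silent (pairs P)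
      silentCentre p v∈P eq eq′ =
        silentPair p (≡.trans eq (centreTrace-∈ v∈P)) (≡.trans eq′ (centreTrace-∈ v∈P))

    CentreCovered : Fin n → Set
    CentreCovered i = ∀ {z} → Partners z (cc i) → z ≡ dd i ⊎ z ≡ ee i → vv i ∈ support P

    centreTaken : ∀ {i y} → Partners (cc i) y → y ≢ dd i → y ≢ ee i → CentreCovered i
    centreTaken pc y≢d _ pz (inj₁ refl) = contradiction (Partners-unique pc (Partners-sym pz)) y≢d
    centreTaken pc _ y≢e pz (inj₂ refl) = contradiction (Partners-unique pc (Partners-sym pz)) y≢e

    -- e i must be dominated, so d i or e i lies in D; its partner gives the silent pair.
    silentRight : ∀ {i} → CentreCovered i → ¬ Partners (dd i) (vv i) → i ∈ silent (pairs P)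
    silentRight {i} covered ¬dv with dd i ∈? support P
    ... | yes d∈P with y , pd ← partner d∈P with dd-Dist≤2⁻ (Partners-close pd) (Partners-≢ pd)
    ...   | inj₁ refl = silentPair pd refl refl refl refl
    ...   | inj₂ (inj₁ refl) = silentCentre pd (covered pd (inj₁ refl)) refl refl refl refl
    ...   | inj₂ (inj₂ (inj₁ refl)) = contradiction pd ¬dv
    ...   | inj₂ (inj₂ (inj₂ refl)) = silentPair pd refl refl refl refl
    silentRight {i} covered ¬dv | no d∉P with dom (ee i)
    ... | inj₂ (_ , d∈P , ed) = contradiction d∈P d∉P
    ... | inj₁ e∈P with y , pe ← partner e∈P with ee-Dist≤2⁻ (Partners-close pe) (Partners-≢ pe)
    ...   | inj₁ refl = contradiction (Partners⇒∈ (Partners-sym pe)) d∉P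
    ...   | inj₂ refl = silentCentre pe (covered pe (inj₂ refl)) refl refl refl refl

    -- a i must be dominated, so a i or b i lies in D; its partner, or failing that the right half, gives the silent pair.
    gadgetSilent : ∀ i → i ∈ silent (pairs P)
    gadgetSilent i with aa i ∈? support P
    ... | yes a∈P with y , pa ← partner a∈P with aa-Dist≤2⁻ (Partners-close pa) (Partners-≢ pa)
    ...   | inj₁ refl = silentPair pa refl refl refl refl
    ...   | inj₂ refl with vv i ∈? support P
    ...     | yes v∈P = silentCentre pa v∈P refl refl refl refl
    ...     | no v∉P = silentRight (centreTaken (Partners-sym pa) (λ ()) (λ ())) (v∉P ∘ Partners⇒∈ ∘ Partners-sym)
    gadgetSilent i | no a∉P with dom (aa i)
    ... | inj₁ a∈P = contradiction a∈P a∉P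
    ... | inj₂ (_ , b∈P , ab) with y , pb ← partner b∈P with bb-Dist≤2⁻ (Partners-close pb) (Partners-≢ pb)
    ...   | inj₁ refl = contradiction (Partners⇒∈ (Partners-sym pb)) a∉P
    ...   | inj₂ (inj₂ (inj₁ refl)) =
      silentRight (λ _ _ → Partners⇒∈ (Partners-sym pb))
                  (λ pdv → contradiction (Partners-unique (Partners-sym pb) (Partners-sym pdv)) λ ())
    ...   | inj₂ (inj₂ (inj₂ refl)) = silentPair pb refl refl refl refl
    ...   | inj₂ (inj₁ refl) with vv i ∈? support P
    ...     | yes v∈P = silentCentre pb v∈P refl refl refl refl
    ...     | no v∉P = silentRight (centreTaken (Partners-sym pb) (λ ()) (λ ())) (v∉P ∘ Partners⇒∈ ∘ Partners-sym)

    n+traces≤size : n + length (traces (pairs P)) ≤ size P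
    n+traces≤size = begin
      n + length (traces (pairs P))                     ≡⟨ +-comm n _ ⟩
      length (traces (pairs P)) + n                     ≤⟨ +-monoʳ-≤ (length (traces (pairs P))) n≤silent ⟩
      length (traces (pairs P)) + length (silent (pairs P)) ≡⟨ length-traces+silent (pairs P) ⟨
      size P                                            ∎
      where
      open ≤-Reasoning
      n≤silent : n ≤ length (silent (pairs P))
      n≤silent = subst (_≤ length (silent (pairs P))) (length-tabulate {n = n} id)
                       (Unique-⊆⇒length≤ (Unique.allFin⁺ n) (λ {i} _ → gadgetSilent i))

    t : ℕ
    t = size P ∸ n

    size≡n+t : size P ≡ n + t
    size≡n+t = ≡.sym (m+[n∸m]≡n (≤-trans (m≤m+n n _) n+traces≤size))

    length-support≡2n+2t : length (support P) ≡ 2 * n + (t + t)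
    length-support≡2n+2t = ≡.trans (InG.length-support P) (≡.trans (cong₂ _+_ size≡n+t size≡n+t) (twice-+ n t))

    projection : Connected H → Fin n → t + t ≤ n →
      ∃ λ (Q : InH.Pairing) → InH.size Q ≡ t × InH.Dominates (InH.support Q)
    projection conn v₀ 2t≤n
      with Q , Q≡t , I⊆Q ← InH.pairingOfSize conn (allFin n) (Unique.allFin⁺ n) ∈-allFin v₀ (traces (pairs P))
                              (traces-close (InG.close P))
                              (+-cancelˡ-≤ n _ _ (subst (n + length (traces (pairs P)) ≤_) size≡n+t n+traces≤size))
                              (subst (t + t ≤_) (≡.sym (length-tabulate {n = n} id)) 2t≤n) =
      Q , Q≡t , InH.Dominates-⊆ I⊆Q traces-dominate

  project-SPDS : Connected H → Fin n → ∀ {k} → k ℤ.≤ + n →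
    HasSPDSOfSize (GP5 H) (+ (2 * n) ℤ.+ k) → HasSPDSOfSize H k
  project-SPDS conn v₀ {k} k≤n (D , spds , len) with P , P↭D ← InG.IsSPDS⇒Pairing spds = result
    where
    open Backward P (InG.Dominates-⊆ (∈-resp-↭ (↭-sym P↭D)) (IsSPDS.dominating spds))

    k≡2t : k ≡ + (t + t)
    k≡2t = ∙-cancelˡ (+ (2 * n)) k (+ (t + t))
      (≡.trans (≡.sym len) (cong +_ (≡.trans (↭-length (↭-sym P↭D)) length-support≡2n+2t)))

    result : HasSPDSOfSize H k
    result with Q , Q≡t , domQ ← projection conn v₀ (drop‿+≤+ (subst (ℤ._≤ + n) k≡2t k≤n)) =
      InH.support Q , InH.Pairing⇒IsSPDS Q domQ ,
      ≡.trans (cong +_ (≡.trans (InH.length-support Q) (cong₂ _+_ Q≡t Q≡t))) (≡.sym k≡2t)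

open GP5Properties using (lift-SPDS; project-SPDS)
open import Data.Integer using (_+_; _≤_)

lemma2 : ∀ {n : ℕ} (H : Graph (Fin n)) → Connected H → 2 Data.Nat.≤ n →
    (k : ℤ) → k ≤ + n →
    (HasSPDSOfSize H k ⇔ HasSPDSOfSize (GP5 H) (+ (2 Data.Nat.* n) + k))
lemma2 H conn n≥2 k k≤n = mk⇔ (lift-SPDS H) (project-SPDS H conn (Fin.fromℕ< n≥2) k≤n)
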